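{- Let $u\geq 3$ and $d\in\{1,\dots,\lfloor u/2\rfloor\}\setminus\{\frac u2\}$. Then the graph $\langle \mathbb Z_u\cup\{\infty_1,\infty_2,\infty_3,\infty_4,\infty_5\},\{d\}\rangle$ can be decomposed into $3$-suns.
   Context: A $3$-sun is the graph on six vertices $a,b,c,d,e,f$ with edges $\{a,b\},\{b,c\},\{c,a\},\{a,d\},\{b,e\},\{c,f\}$; a decomposition of a graph into $3$-suns is a partition of its edge set into subgraphs isomorphic to a $3$-sun. For a positive integer $u$, $\mathbb Z_u=\{0,1,\dots,u-1\}$ (integers mod $u$), and for distinct $i,j\in\mathbb Z_u$, $|i-j|_u=\min\{|i-j|,u-|i-j|\}$. For a set $H$ disjoint from $\mathbb Z_u$ and a nonempty set $D\subseteq\{1,\dots,\lfloor u/2\rfloor\}$, $\langle \mathbb Z_u\cup H,D\rangle$ is the graph with vertex set $\mathbb Z_u\cup H$ and edge set $\{\{i,j\}: i,j\in\mathbb Z_u,\ |i-j|_u\in D\}\cup\{\{\infty,i\}:\infty\in H,\ i\in\mathbb Z_u\}$. -}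

module Defs where

open import Data.Nat using (ℕ; _∸_; _⊓_; ∣_-_∣)
open import Data.Fin using (Fin; toℕ)
open import Data.Sum using (_⊎_; inj₁; inj₂)
open import Data.Product using (_×_; _,_; Σ; ∃)
open import Data.Unit using (⊤)
open import Data.Empty using (⊥)
open import Data.List using (List; []; _∷_; length; lookup)
open import Data.List.Relation.Unary.All using (All)
open import Data.List.Relation.Unary.Any using (Any)
open import Data.List.Relation.Unary.Unique.Propositional using (Unique)
open import Relation.Binary.PropositionalEquality using (_≡_)

record Graph : Set₁ where
  field
    V   : Set
    Adj : V → V → Set

cdist : (u : ℕ) → Fin u → Fin u → ℕ
cdist u i j = ∣ toℕ i - toℕ j ∣ ⊓ (u ∸ ∣ toℕ i - toℕ j ∣)

-- The graph ⟨ Z_u ∪ H , {d} ⟩ with H = {∞_1,…,∞_h} represented as Fin h.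
-- Vertices: inj₁ i for i ∈ Z_u, inj₂ k for ∞_{k+1}.
ZuH-adj : (u h d : ℕ) → Fin u ⊎ Fin h → Fin u ⊎ Fin h → Set
ZuH-adj u h d (inj₁ i) (inj₁ j) = cdist u i j ≡ d
ZuH-adj u h d (inj₁ i) (inj₂ k) = ⊤
ZuH-adj u h d (inj₂ k) (inj₁ i) = ⊤
ZuH-adj u h d (inj₂ k) (inj₂ l) = ⊥

CirculantPlusInf : (u h d : ℕ) → Graph
CirculantPlusInf u h d = record { V = Fin u ⊎ Fin h ; Adj = ZuH-adj u h d }

record Sun (V : Set) : Set where
  constructor sun
  field
    a b c d e f : V

module _ {V : Set} where
  sunVerts : Sun V → List V
  sunVerts (sun a b c d e f) = a ∷ b ∷ c ∷ d ∷ e ∷ f ∷ []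

  sunEdges : Sun V → List (V × V)
  sunEdges (sun a b c d e f) =
    (a , b) ∷ (b , c) ∷ (c , a) ∷ (a , d) ∷ (b , e) ∷ (c , f) ∷ []

  SunHasEdge : Sun V → V → V → Set
  SunHasEdge s x y =
    Any (λ { (p , q) → (p ≡ x × q ≡ y) ⊎ (p ≡ y × q ≡ x) }) (sunEdges s)

record SunDecomposition (G : Graph) : Set where
  open Graph G
  field
    suns      : List (Sun V)
    distinct  : All (λ s → Unique (sunVerts s)) suns
    inGraph   : All (λ s → All (λ { (p , q) → Adj p q }) (sunEdges s)) suns
    covers    : ∀ x y → Adj x y →
                Σ (Fin (length suns)) λ k → SunHasEdge (lookup suns k) x y
    unique    : ∀ x y → Adj x y → (k l : Fin (length suns)) →
                SunHasEdge (lookup suns k) x y →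
                SunHasEdge (lookup suns l) x y → k ≡ l

-- The sun at i ∈ Z_u has triangle {∞_a, i, i + d} and pendant edges {∞_a, i − d},
-- {i, ∞_e}, {i + d, ∞_f}.  Its only d-edge is {i, i + d}, and every vertex z lies on
-- five infinity edges of these suns (two at z − d, two at z, one at z + d), so the
-- suns decompose the graph as soon as these five edges end at distinct ∞'s.
-- The map x ↦ x + d splits Z_u into cycles of length L = u / gcd(d, u) ≥ 3 (as
-- 2d < u), and the colours are read off a closed walk of length L in a small
-- automaton, following each cycle.

module Submission where

open import Defs
open import Data.Nat using (ℕ; zero; suc; pred; _+_; _*_; _∸_; _⊓_; ∣_-_∣; _≤_; _<_; z≤n; s≤s; NonZero; >-nonZero; ≢-nonZero; ≢-nonZero⁻¹)
open import Data.Nat.Properties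
open import Data.Nat.DivMod
open import Data.Nat.Divisibility using (divides-refl; ∣⇒≤)
open import Data.Nat.GCD using (gcd; gcd-GCD; gcd[m,n]∣m; gcd[m,n]∣n; gcd[m,n]≢0; n/gcd[m,n]≢0; module Bézout)
open import Data.Nat.Tactic.RingSolver using (solve-∀)
open import Data.Fin using (Fin; zero; suc; toℕ; fromℕ<; #_; cast)
open import Data.Fin.Properties using (toℕ-fromℕ<; toℕ<n; toℕ-injective; cast-involutive; pigeonhole; any?) renaming (_≟_ to _≟ᶠ_)
open import Data.Product using (_×_; _,_; proj₁; proj₂; ∃-syntax)
open import Data.Sum using (_⊎_; inj₁; inj₂; swap)
open import Data.Sum.Properties using (inj₁-injective; inj₂-injective)
open import Data.Unit using (tt)
open import Data.List using (tabulate; lookup; length)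
open import Data.List.Properties using (length-tabulate; lookup-tabulate)
open import Data.List.Relation.Unary.All using (All; []; _∷_)
open import Data.List.Relation.Unary.All.Properties using (tabulate⁺)
open import Data.List.Relation.Unary.AllPairs using ([]; _∷_)
import Data.List.Relation.Unary.Any as Any
open Any using (here; there)
import Data.List.Relation.Unary.Unique.Propositional as List
open import Data.Vec using (Vec; []; _∷_)
open Data.Vec using () renaming (lookup to infixl 5 _!_)
open import Data.Vec.Relation.Unary.AllPairs using (allPairs?)
open import Data.Vec.Relation.Unary.Unique.Propositional using (Unique)
open import Data.Vec.Relation.Unary.Unique.Propositional.Properties using (lookup-injective)
open import Function using (_∘_)
open import Relation.Binary.PropositionalEquality
open import Relation.Nullary using (¬_; ¬?; yes; no; Dec; contradiction)
open import Relation.Nullary.Decidable using (True; toWitness)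

open ≤-Reasoning

[m%n+k]%n≡[m+k]%n : ∀ m k n .{{_ : NonZero n}} → (m % n + k) % n ≡ (m + k) % n
[m%n+k]%n≡[m+k]%n m k n = begin-equality
  (m % n + k) % n          ≡⟨ %-distribˡ-+ (m % n) k n ⟩
  (m % n % n + k % n) % n  ≡⟨ cong (λ r → (r + k % n) % n) (m%n%n≡m%n m n) ⟩
  (m % n + k % n) % n      ≡⟨ %-distribˡ-+ m k n ⟨
  (m + k) % n              ∎

[1+m%n]%n≡[1+m]%n : ∀ m n .{{_ : NonZero n}} → suc (m % n) % n ≡ suc m % n
[1+m%n]%n≡[1+m]%n m n = begin-equality
  suc (m % n) % n  ≡⟨ cong (_% n) (+-comm 1 (m % n)) ⟩
  (m % n + 1) % n  ≡⟨ [m%n+k]%n≡[m+k]%n m 1 n ⟩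
  (m + 1) % n      ≡⟨ cong (_% n) (+-comm m 1) ⟩
  suc m % n        ∎

module _ (u : ℕ) .{{_ : NonZero u}} where

  shift : ℕ → Fin u → Fin u
  shift k x = fromℕ< (m%n<n (toℕ x + k) u)

  toℕ-shift : ∀ k x → toℕ (shift k x) ≡ (toℕ x + k) % u
  toℕ-shift k x = toℕ-fromℕ< (m%n<n (toℕ x + k) u)

  shift-cancel : ∀ {k l} → k + l ≡ u → ∀ x → shift l (shift k x) ≡ x
  shift-cancel {k} {l} k+l≡u x = toℕ-injective (begin-equality
    toℕ (shift l (shift k x))   ≡⟨ toℕ-shift l (shift k x) ⟩
    (toℕ (shift k x) + l) % u   ≡⟨ cong (λ r → (r + l) % u) (toℕ-shift k x) ⟩
    ((toℕ x + k) % u + l) % u   ≡⟨ [m%n+k]%n≡[m+k]%n (toℕ x + k) l u ⟩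
    (toℕ x + k + l) % u         ≡⟨ cong (_% u) (trans (+-assoc (toℕ x) k l) (cong (toℕ x +_) k+l≡u)) ⟩
    (toℕ x + u) % u             ≡⟨ [m+n]%n≡m%n (toℕ x) u ⟩
    toℕ x % u                   ≡⟨ m<n⇒m%n≡m (toℕ<n x) ⟩
    toℕ x                       ∎)

  toℕ≡⇒≡shift : ∀ {k} x {y} → toℕ y ≡ (toℕ x + k) % u → y ≡ shift k x
  toℕ≡⇒≡shift {k} x eq = toℕ-injective (trans eq (sym (toℕ-shift k x)))

  circ : ℕ → ℕ
  circ k = k ⊓ (u ∸ k)

  circ-self : ∀ {d} → d + d ≤ u → circ d ≡ d
  circ-self {d} d+d≤u = m≤n⇒m⊓n≡m (m+n≤o⇒m≤o∸n d d+d≤u)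

  circ-complement : ∀ {d} → d + d ≤ u → circ (u ∸ d) ≡ d
  circ-complement {d} d+d≤u = begin-equality
    (u ∸ d) ⊓ (u ∸ (u ∸ d))  ≡⟨ cong ((u ∸ d) ⊓_) (m∸[m∸n]≡n (m+n≤o⇒n≤o d d+d≤u)) ⟩
    (u ∸ d) ⊓ d              ≡⟨ m≥n⇒m⊓n≡n (m+n≤o⇒m≤o∸n d d+d≤u) ⟩
    d                        ∎

  chord⇒shift : ∀ {a b d} → a ≤ b → b < u → circ (b ∸ a) ≡ d →
                b ≡ (a + d) % u ⊎ a ≡ (b + d) % u
  chord⇒shift {a} {b} {d} a≤b b<u circ≡d with ⊓-sel (b ∸ a) (u ∸ (b ∸ a))
  ... | inj₁ p = inj₁ (begin-equality
    b                  ≡⟨ m<n⇒m%n≡m b<u ⟨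
    b % u              ≡⟨ cong (_% u) (m+[n∸m]≡n a≤b) ⟨
    (a + (b ∸ a)) % u  ≡⟨ cong (λ r → (a + r) % u) (trans (sym p) circ≡d) ⟩
    (a + d) % u        ∎)
  ... | inj₂ p = inj₂ (begin-equality
    a            ≡⟨ m<n⇒m%n≡m (≤-<-trans a≤b b<u) ⟨
    a % u        ≡⟨ [m+n]%n≡m%n a u ⟨
    (a + u) % u  ≡⟨ cong (_% u) a+u≡b+d ⟩
    (b + d) % u  ∎)
    where
    a+u≡b+d : a + u ≡ b + d
    a+u≡b+d = begin-equality
      a + u                                ≡⟨ cong (a +_) (m+[n∸m]≡n (≤-trans (m∸n≤m b a) (<⇒≤ b<u))) ⟨
      a + ((b ∸ a) + (u ∸ (b ∸ a)))        ≡⟨ +-assoc a (b ∸ a) (u ∸ (b ∸ a)) ⟨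
      (a + (b ∸ a)) + (u ∸ (b ∸ a))        ≡⟨ cong₂ _+_ (m+[n∸m]≡n a≤b) (trans (sym p) circ≡d) ⟩
      b + d                                ∎

  cdist≡⇒shift : ∀ {d} x y → cdist u x y ≡ d → y ≡ shift d x ⊎ x ≡ shift d y
  cdist≡⇒shift {d} x y eq with ≤-total (toℕ x) (toℕ y)
  ... | inj₁ x≤y with chord⇒shift x≤y (toℕ<n y) (subst (λ k → circ k ≡ d) (m≤n⇒∣m-n∣≡n∸m x≤y) eq)
  ...   | inj₁ y≡ = inj₁ (toℕ≡⇒≡shift x y≡)
  ...   | inj₂ x≡ = inj₂ (toℕ≡⇒≡shift y x≡)
  cdist≡⇒shift {d} x y eq | inj₂ y≤x with chord⇒shift y≤x (toℕ<n x) (subst (λ k → circ k ≡ d) (m≤n⇒∣n-m∣≡n∸m y≤x) eq)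
  ...   | inj₁ x≡ = inj₂ (toℕ≡⇒≡shift y x≡)
  ...   | inj₂ y≡ = inj₁ (toℕ≡⇒≡shift x y≡)

  ∣a-[a+d]%u∣ : ∀ {a d} → a < u → d ≤ u → ∣ a - (a + d) % u ∣ ≡ d ⊎ ∣ a - (a + d) % u ∣ ≡ u ∸ d
  ∣a-[a+d]%u∣ {a} {d} a<u d≤u with a + d <? u
  ... | yes a+d<u = inj₁ (trans (cong (∣ a -_∣) (m<n⇒m%n≡m a+d<u)) (∣m-m+n∣≡n a d))
  ... | no a+d≮u = inj₂ (begin-equality
    ∣ a - (a + d) % u ∣            ≡⟨ cong (∣ a -_∣) (trans (sym (m≤n⇒[n∸m]%m≡n%m u≤a+d)) (m<n⇒m%n≡m b<u)) ⟩
    ∣ a - b ∣                      ≡⟨ cong (∣_- b ∣) b+[u∸d]≡a ⟨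
    ∣ b + (u ∸ d) - b ∣            ≡⟨ ∣-∣-comm (b + (u ∸ d)) b ⟩
    ∣ b - b + (u ∸ d) ∣            ≡⟨ ∣m-m+n∣≡n b (u ∸ d) ⟩
    u ∸ d                          ∎)
    where
    u≤a+d : u ≤ a + d
    u≤a+d = ≮⇒≥ a+d≮u
    b : ℕ
    b = a + d ∸ u
    b+[u∸d]≡a : b + (u ∸ d) ≡ a
    b+[u∸d]≡a = +-cancelʳ-≡ d (b + (u ∸ d)) a (begin-equality
      b + (u ∸ d) + d    ≡⟨ +-assoc b (u ∸ d) d ⟩
      b + ((u ∸ d) + d)  ≡⟨ cong (b +_) (m∸n+n≡m d≤u) ⟩
      b + u              ≡⟨ m∸n+n≡m u≤a+d ⟩
      a + d              ∎)
    b<u : b < u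
    b<u = ≤-<-trans (subst (b ≤_) b+[u∸d]≡a (m≤m+n b (u ∸ d))) a<u

  cdist-shift : ∀ {d} → d + d ≤ u → ∀ x → cdist u x (shift d x) ≡ d
  cdist-shift {d} d+d≤u x rewrite toℕ-shift d x
    with ∣a-[a+d]%u∣ (toℕ<n x) (m+n≤o⇒n≤o d d+d≤u)
  ... | inj₁ eq = trans (cong circ eq) (circ-self d+d≤u)
  ... | inj₂ eq = trans (cong circ eq) (circ-complement d+d≤u)

module _ (G : Graph) {n : ℕ} (S : Fin n → Sun (Graph.V G)) where
  open Graph G

  private
    index : Fin n → Fin (length (tabulate S))
    index = cast (sym (length-tabulate S))

    index∘cast : ∀ k → index (cast (length-tabulate S) k) ≡ k
    index∘cast = cast-involutive (sym (length-tabulate S)) (length-tabulate S)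

    cast-injective : ∀ {k l} → cast (length-tabulate S) k ≡ cast (length-tabulate S) l → k ≡ l
    cast-injective {k} {l} eq =
      trans (sym (index∘cast k)) (trans (cong index eq) (index∘cast l))

    lookup-tabulate⁻ : ∀ k → lookup (tabulate S) k ≡ S (cast (length-tabulate S) k)
    lookup-tabulate⁻ k =
      trans (cong (lookup (tabulate S)) (sym (index∘cast k))) (lookup-tabulate S _)

  familyDecomposition :
    (∀ i → List.Unique (sunVerts (S i))) →
    (∀ i → All (λ e → Adj (proj₁ e) (proj₂ e)) (sunEdges (S i))) →
    (∀ x y → Adj x y → ∃[ i ] SunHasEdge (S i) x y) →
    (∀ x y → Adj x y → ∀ i j → SunHasEdge (S i) x y → SunHasEdge (S j) x y → i ≡ j) →
    SunDecomposition G
  familyDecomposition distinct inGraph covers unique = record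
    { suns     = tabulate S
    ; distinct = tabulate⁺ distinct
    ; inGraph  = tabulate⁺ inGraph
    ; covers   = λ x y xy → let (i , has) = covers x y xy in
        index i , subst (λ s → SunHasEdge s x y) (sym (lookup-tabulate S i)) has
    ; unique   = λ x y xy k l hasₖ hasₗ → cast-injective (unique x y xy _ _
        (subst (λ s → SunHasEdge s x y) (lookup-tabulate⁻ k) hasₖ)
        (subst (λ s → SunHasEdge s x y) (lookup-tabulate⁻ l) hasₗ))
    }

Fin-injective⇒surjective : ∀ {n} (f : Fin n → Fin n) → (∀ {i j} → f i ≡ f j → i ≡ j) →
                           ∀ y → ∃[ i ] f i ≡ y
Fin-injective⇒surjective {n} f f-injective y with any? (λ i → f i ≟ᶠ y)
... | yes hit = hit
... | no miss with pigeonhole (n<1+n n) extend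
  where
  extend : Fin (suc n) → Fin n
  extend zero = y
  extend (suc i) = f i
... | zero , suc j , _ , y≡fj = contradiction (j , sym y≡fj) miss
... | suc i , suc j , i<j , fi≡fj with f-injective fi≡fj
...   | refl = contradiction i<j (<-irrefl refl)

SunHasEdge-sym : ∀ {V : Set} (s : Sun V) {x y} → SunHasEdge s x y → SunHasEdge s y x
SunHasEdge-sym s = Any.map swap

module CirculantSuns (u d : ℕ) .{{_ : NonZero u}} (d+d≤u : d + d ≤ u) where

  P M : Fin u → Fin u
  P = shift u d
  M = shift u (u ∸ d)

  d≤u : d ≤ u
  d≤u = m+n≤o⇒n≤o d d+d≤u

  P∘M : ∀ x → P (M x) ≡ x
  P∘M = shift-cancel u (m∸n+n≡m d≤u)

  M∘P : ∀ x → M (P x) ≡ x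
  M∘P = shift-cancel u (m+[n∸m]≡n d≤u)

  V : Set
  V = Fin u ⊎ Fin 5

  module _ (colour : Fin u → Vec (Fin 5) 3) where

    A B C : Fin u → Fin 5
    A i = colour i ! # 0
    B i = colour i ! # 1
    C i = colour i ! # 2

    sunAt : Fin u → Sun V
    sunAt i = sun (inj₂ (A i)) (inj₁ i) (inj₁ (P i)) (inj₁ (M i)) (inj₂ (B i)) (inj₂ (C i))

    -- The five infinity edges at z lie in the suns at z − d (as c–a and c–f), at z
    -- (as a–b and b–e) and at z + d (as a–d).
    vertexSuns : Fin u → Vec (Fin u) 5
    vertexSuns z = M z ∷ z ∷ P z ∷ z ∷ M z ∷ []

    vertexColours : Fin u → Vec (Fin 5) 5
    vertexColours z = A (M z) ∷ A z ∷ A (P z) ∷ B z ∷ C (M z) ∷ []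

    sunAt-∞edge : ∀ z s → SunHasEdge (sunAt (vertexSuns z ! s)) (inj₁ z)
                                     (inj₂ (vertexColours z ! s))
    sunAt-∞edge z zero = there (there (here (inj₁ (cong inj₁ (P∘M z) , refl))))
    sunAt-∞edge z (suc zero) = here (inj₂ (refl , refl))
    sunAt-∞edge z (suc (suc zero)) =
      there (there (there (here (inj₂ (refl , cong inj₁ (M∘P z))))))
    sunAt-∞edge z (suc (suc (suc zero))) =
      there (there (there (there (here (inj₁ (refl , refl))))))
    sunAt-∞edge z (suc (suc (suc (suc zero)))) =
      there (there (there (there (there (here (inj₁ (cong inj₁ (P∘M z) , refl)))))))

    ∞edge-slot : ∀ {i z c} → SunHasEdge (sunAt i) (inj₁ z) (inj₂ c) →
                 ∃[ s ] i ≡ vertexSuns z ! s × c ≡ vertexColours z ! s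
    ∞edge-slot (here (inj₁ (() , _)))
    ∞edge-slot (here (inj₂ (refl , refl))) = # 1 , refl , refl
    ∞edge-slot (there (here (inj₁ (_ , ()))))
    ∞edge-slot (there (here (inj₂ (() , _))))
    ∞edge-slot {i} (there (there (here (inj₁ (refl , refl))))) = # 0 , sym (M∘P i) , cong A (sym (M∘P i))
    ∞edge-slot (there (there (here (inj₂ (() , _)))))
    ∞edge-slot (there (there (there (here (inj₁ (() , _))))))
    ∞edge-slot {i} (there (there (there (here (inj₂ (refl , refl)))))) = # 2 , sym (P∘M i) , cong A (sym (P∘M i))
    ∞edge-slot (there (there (there (there (here (inj₁ (refl , refl))))))) = # 3 , refl , refl
    ∞edge-slot (there (there (there (there (here (inj₂ (() , _)))))))
    ∞edge-slot {i} (there (there (there (there (there (here (inj₁ (refl , refl)))))))) =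
      # 4 , sym (M∘P i) , cong C (sym (M∘P i))
    ∞edge-slot (there (there (there (there (there (here (inj₂ (() , _))))))))

    cycleEdge-ends : ∀ {i x y} → SunHasEdge (sunAt i) (inj₁ x) (inj₁ y) →
                     (x ≡ i × y ≡ P i) ⊎ (y ≡ i × x ≡ P i)
    cycleEdge-ends (here (inj₁ (() , _)))
    cycleEdge-ends (here (inj₂ (() , _)))
    cycleEdge-ends (there (here (inj₁ (refl , refl)))) = inj₁ (refl , refl)
    cycleEdge-ends (there (here (inj₂ (refl , refl)))) = inj₂ (refl , refl)
    cycleEdge-ends (there (there (here (inj₁ (_ , ())))))
    cycleEdge-ends (there (there (here (inj₂ (_ , ())))))
    cycleEdge-ends (there (there (there (here (inj₁ (() , _))))))
    cycleEdge-ends (there (there (there (here (inj₂ (() , _))))))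
    cycleEdge-ends (there (there (there (there (here (inj₁ (_ , ())))))))
    cycleEdge-ends (there (there (there (there (here (inj₂ (_ , ())))))))
    cycleEdge-ends (there (there (there (there (there (here (inj₁ (_ , ()))))))))
    cycleEdge-ends (there (there (there (there (there (here (inj₂ (_ , ()))))))))

    module _ (colour-unique : ∀ i → Unique (colour i))
             (vertexColours-unique : ∀ z → Unique (vertexColours z)) where

      -- Distinct colours at x, resp. at x + d, rule out x + d ≡ x, resp. x + 2d ≡ x.
      P≢id : ∀ x → P x ≢ x
      P≢id x Px≡x = contradiction
        (lookup-injective (vertexColours-unique x) (# 0) (# 1) (cong A (trans (cong M (sym Px≡x)) (M∘P x))))
        λ ()

      P∘P≢id : ∀ x → P (P x) ≢ x
      P∘P≢id x PPx≡x = contradiction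
        (lookup-injective (vertexColours-unique (P x)) (# 0) (# 2) (cong A (trans (M∘P x) (sym PPx≡x))))
        λ ()

      sunAt-distinct : ∀ i → List.Unique (sunVerts (sunAt i))
      sunAt-distinct i =
          ((λ ()) ∷ (λ ()) ∷ (λ ()) ∷ (A≢B ∘ inj₂-injective) ∷ (A≢C ∘ inj₂-injective) ∷ [])
        ∷ ((P≢id i ∘ sym ∘ inj₁-injective) ∷ (M≢id ∘ sym ∘ inj₁-injective) ∷ (λ ()) ∷ (λ ()) ∷ [])
        ∷ (P≢M ∘ inj₁-injective ∷ (λ ()) ∷ (λ ()) ∷ [])
        ∷ ((λ ()) ∷ (λ ()) ∷ [])
        ∷ ((B≢C ∘ inj₂-injective) ∷ [])
        ∷ [] ∷ []
        where
        colours-≢ : ∀ {s t} → s ≢ t → colour i ! s ≢ colour i ! t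
        colours-≢ s≢t = s≢t ∘ lookup-injective (colour-unique i) _ _
        A≢B : A i ≢ B i
        A≢B = colours-≢ λ ()
        A≢C : A i ≢ C i
        A≢C = colours-≢ λ ()
        B≢C : B i ≢ C i
        B≢C = colours-≢ λ ()
        M≢id : M i ≢ i
        M≢id Mi≡i = P≢id i (trans (cong P (sym Mi≡i)) (P∘M i))
        P≢M : P i ≢ M i
        P≢M Pi≡Mi = P∘P≢id i (trans (cong P Pi≡Mi) (P∘M i))

      sunAt-inGraph : ∀ i → All (λ e → ZuH-adj u 5 d (proj₁ e) (proj₂ e)) (sunEdges (sunAt i))
      sunAt-inGraph i = tt ∷ cdist-shift u d+d≤u i ∷ tt ∷ tt ∷ tt ∷ tt ∷ []

      ∞edge-covered : ∀ z c → ∃[ i ] SunHasEdge (sunAt i) (inj₁ z) (inj₂ c)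
      ∞edge-covered z c =
        let (s , colour≡c) = Fin-injective⇒surjective (vertexColours z !_)
                               (lookup-injective (vertexColours-unique z) _ _) c
        in vertexSuns z ! s ,
           subst (λ c → SunHasEdge (sunAt (vertexSuns z ! s)) (inj₁ z) (inj₂ c)) colour≡c (sunAt-∞edge z s)

      ∞edge-unique : ∀ {i j z c} → SunHasEdge (sunAt i) (inj₁ z) (inj₂ c) →
                     SunHasEdge (sunAt j) (inj₁ z) (inj₂ c) → i ≡ j
      ∞edge-unique {z = z} hasᵢ hasⱼ with ∞edge-slot hasᵢ | ∞edge-slot hasⱼ
      ... | s , i≡ , c≡ | t , j≡ , c≡′
        with lookup-injective (vertexColours-unique z) s t (trans (sym c≡) c≡′)
      ...   | refl = trans i≡ (sym j≡)

      cycleEdge-unique : ∀ {i j x y} → SunHasEdge (sunAt i) (inj₁ x) (inj₁ y) →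
                         SunHasEdge (sunAt j) (inj₁ x) (inj₁ y) → i ≡ j
      cycleEdge-unique hasᵢ hasⱼ with cycleEdge-ends hasᵢ | cycleEdge-ends hasⱼ
      ... | inj₁ (x≡i , _) | inj₁ (x≡j , _) = trans (sym x≡i) x≡j
      ... | inj₂ (y≡i , _) | inj₂ (y≡j , _) = trans (sym y≡i) y≡j
      ... | inj₁ (refl , refl) | inj₂ (Pi≡j , i≡Pj) = contradiction (trans (cong P Pi≡j) (sym i≡Pj)) (P∘P≢id _)
      ... | inj₂ (refl , refl) | inj₁ (Pi≡j , i≡Pj) = contradiction (trans (cong P Pi≡j) (sym i≡Pj)) (P∘P≢id _)

      covers : ∀ x y → ZuH-adj u 5 d x y → ∃[ i ] SunHasEdge (sunAt i) x y
      covers (inj₁ x) (inj₁ y) adj with cdist≡⇒shift u x y adj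
      ... | inj₁ y≡Px = x , there (here (inj₁ (refl , cong inj₁ (sym y≡Px))))
      ... | inj₂ x≡Py = y , there (here (inj₂ (refl , cong inj₁ (sym x≡Py))))
      covers (inj₁ z) (inj₂ c) _ = ∞edge-covered z c
      covers (inj₂ c) (inj₁ z) _ = let (i , has) = ∞edge-covered z c in i , SunHasEdge-sym (sunAt i) has

      unique : ∀ x y → ZuH-adj u 5 d x y → ∀ i j →
               SunHasEdge (sunAt i) x y → SunHasEdge (sunAt j) x y → i ≡ j
      unique (inj₁ x) (inj₁ y) _ i j = cycleEdge-unique
      unique (inj₁ z) (inj₂ c) _ i j = ∞edge-unique
      unique (inj₂ c) (inj₁ z) _ i j hasᵢ hasⱼ =
        ∞edge-unique (SunHasEdge-sym (sunAt i) hasᵢ) (SunHasEdge-sym (sunAt j) hasⱼ)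

      sunDecomposition : SunDecomposition (CirculantPlusInf u 5 d)
      sunDecomposition = familyDecomposition (CirculantPlusInf u 5 d) sunAt
        sunAt-distinct sunAt-inGraph covers unique

gcd≡multiple-mod : ∀ m n .{{_ : NonZero n}} → ∃[ w ] m * w % n ≡ gcd m n % n
gcd≡multiple-mod m n@(suc n-1) with Bézout.identity (gcd-GCD m n)
... | Bézout.+- x y g+yn≡xm = x , (begin-equality
  m * x % n              ≡⟨ cong (_% n) (*-comm m x) ⟩
  x * m % n              ≡⟨ cong (_% n) g+yn≡xm ⟨
  (gcd m n + y * n) % n  ≡⟨ [m+kn]%n≡m%n (gcd m n) y n ⟩
  gcd m n % n            ∎)
-- Here g ≡ −x m (mod n), and −x ≡ x (n − 1) (mod n).
... | Bézout.-+ x y g+xm≡yn = x * n-1 , (begin-equality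
  m * (x * n-1) % n                        ≡⟨ [m+kn]%n≡m%n (m * (x * n-1)) y n ⟨
  (m * (x * n-1) + y * n) % n              ≡⟨ cong (λ r → (m * (x * n-1) + r) % n) g+xm≡yn ⟨
  (m * (x * n-1) + (gcd m n + x * m)) % n  ≡⟨ cong (_% n) (regroup m x n-1 (gcd m n)) ⟩
  (gcd m n + x * m * n) % n                ≡⟨ [m+kn]%n≡m%n (gcd m n) (x * m) n ⟩
  gcd m n % n                              ∎)
  where
  regroup : ∀ m x k g → m * (x * k) + (g + x * m) ≡ g + x * m * suc k
  regroup = solve-∀

module CyclePosition (u d : ℕ) .{{_ : NonZero u}} (1≤d : 1 ≤ d) (d+d<u : d + d < u) where

  g : ℕ
  g = gcd d u

  instance
    g≢0 : NonZero g
    g≢0 = ≢-nonZero (gcd[m,n]≢0 d u (inj₂ (≢-nonZero⁻¹ u)))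

  L : ℕ
  L = u / g

  instance
    L≢0 : NonZero L
    L≢0 = ≢-nonZero (n/gcd[m,n]≢0 d u)

  L*g≡u : L * g ≡ u
  L*g≡u = m/n*n≡m (gcd[m,n]∣n d u)

  g≤d : g ≤ d
  g≤d = ∣⇒≤ {{>-nonZero 1≤d}} (gcd[m,n]∣m d u)

  3≤L : 3 ≤ L
  3≤L = *-cancelʳ-< g 2 L (begin-strict
    2 * g    ≤⟨ *-monoʳ-≤ 2 g≤d ⟩
    2 * d    ≡⟨ cong (d +_) (+-identityʳ d) ⟩
    d + d    <⟨ d+d<u ⟩
    u        ≡⟨ L*g≡u ⟨
    L * g    ∎)

  w : ℕ
  w = proj₁ (gcd≡multiple-mod d u)

  d*w≡g+[d*w/u]*u : d * w ≡ g + (d * w / u) * u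
  d*w≡g+[d*w/u]*u = begin-equality
    d * w                          ≡⟨ m≡m%n+[m/n]*n (d * w) u ⟩
    d * w % u + (d * w / u) * u    ≡⟨ cong (_+ (d * w / u) * u) (proj₂ (gcd≡multiple-mod d u)) ⟩
    g % u + (d * w / u) * u        ≡⟨ cong (_+ (d * w / u) * u) (m<n⇒m%n≡m g<u) ⟩
    g + (d * w / u) * u            ∎
    where
    g<u : g < u
    g<u = ≤-<-trans g≤d (≤-<-trans (m≤m+n d d) d+d<u)

  -- With d w ≡ g (mod u), the position of n on its cycle of x ↦ x + d is ⌊n w / g⌋ mod L.
  position : ℕ → ℕ
  position n = n * w / g % L

  [m+c*u]/g%L≡m/g%L : ∀ m c → (m + c * u) / g % L ≡ m / g % L
  [m+c*u]/g%L≡m/g%L m c = begin-equality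
    (m + c * u) / g % L            ≡⟨ cong (λ r → (m + c * r) / g % L) L*g≡u ⟨
    (m + c * (L * g)) / g % L      ≡⟨ cong (λ r → (m + r) / g % L) (*-assoc c L g) ⟨
    (m + c * L * g) / g % L        ≡⟨ cong (_% L) (+-distrib-/-∣ʳ m {d = g} (divides-refl (c * L))) ⟩
    (m / g + c * L * g / g) % L    ≡⟨ cong (λ r → (m / g + r) % L) (m*n/n≡m (c * L) g) ⟩
    (m / g + c * L) % L            ≡⟨ [m+kn]%n≡m%n (m / g) c L ⟩
    m / g % L                      ∎

  position-periodic : ∀ n k → position (n + k * u) ≡ position n
  position-periodic n k = begin-equality
    (n + k * u) * w / g % L        ≡⟨ cong (λ r → r / g % L) (distribute n k u w) ⟩
    (n * w + k * w * u) / g % L    ≡⟨ [m+c*u]/g%L≡m/g%L (n * w) (k * w) ⟩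
    n * w / g % L                  ∎
    where
    distribute : ∀ n k u w → (n + k * u) * w ≡ n * w + k * w * u
    distribute = solve-∀

  position-% : ∀ n → position (n % u) ≡ position n
  position-% n = begin-equality
    position (n % u)                  ≡⟨ position-periodic (n % u) (n / u) ⟨
    position (n % u + (n / u) * u)    ≡⟨ cong position (m≡m%n+[m/n]*n n u) ⟨
    position n                        ∎

  position-+d : ∀ n → position (n + d) ≡ suc (position n) % L
  position-+d n = begin-equality
    (n + d) * w / g % L                    ≡⟨ cong (λ r → r / g % L) (distribute n d w) ⟩
    (n * w + d * w) / g % L                ≡⟨ cong (λ r → (n * w + r) / g % L) d*w≡g+[d*w/u]*u ⟩
    (n * w + (g + (d * w / u) * u)) / g % L ≡⟨ cong (λ r → r / g % L) (+-assoc (n * w) g _) ⟨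
    (n * w + g + (d * w / u) * u) / g % L  ≡⟨ [m+c*u]/g%L≡m/g%L (n * w + g) (d * w / u) ⟩
    (n * w + g) / g % L                    ≡⟨ cong (_% L) (m/n≡1+[m∸n]/n (m≤n+m g (n * w))) ⟩
    suc ((n * w + g ∸ g) / g) % L          ≡⟨ cong (λ r → suc (r / g) % L) (m+n∸n≡m (n * w) g) ⟩
    suc (n * w / g) % L                    ≡⟨ [1+m%n]%n≡[1+m]%n (n * w / g) L ⟨
    suc (position n) % L                   ∎
    where
    distribute : ∀ n d w → (n + d) * w ≡ n * w + d * w
    distribute = solve-∀

  position-shift : ∀ x → position (toℕ (shift u d x)) ≡ suc (position (toℕ x)) % L
  position-shift x = begin-equality
    position (toℕ (shift u d x))   ≡⟨ cong position (toℕ-shift u d x) ⟩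
    position ((toℕ x + d) % u)     ≡⟨ position-% (toℕ x + d) ⟩
    position (toℕ x + d)           ≡⟨ position-+d (toℕ x) ⟩
    suc (position (toℕ x)) % L     ∎

data State : Set where
  X0 X1 X2 F0 F1 F2 F3 G0 G1 G2 G3 G4 : State

palette : State → Vec (Fin 5) 3
palette X0 = # 0 ∷ # 3 ∷ # 4 ∷ []
palette X1 = # 1 ∷ # 3 ∷ # 4 ∷ []
palette X2 = # 2 ∷ # 3 ∷ # 4 ∷ []
palette F0 = # 0 ∷ # 3 ∷ # 4 ∷ []
palette F1 = # 1 ∷ # 3 ∷ # 0 ∷ []
palette F2 = # 2 ∷ # 3 ∷ # 1 ∷ []
palette F3 = # 4 ∷ # 3 ∷ # 2 ∷ []
palette G0 = # 0 ∷ # 3 ∷ # 4 ∷ []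
palette G1 = # 1 ∷ # 3 ∷ # 0 ∷ []
palette G2 = # 2 ∷ # 4 ∷ # 0 ∷ []
palette G3 = # 3 ∷ # 1 ∷ # 2 ∷ []
palette G4 = # 4 ∷ # 1 ∷ # 2 ∷ []

α β γ : State → Fin 5
α s = palette s ! # 0
β s = palette s ! # 1
γ s = palette s ! # 2

-- Every closed walk of length L in this graph colours a cycle of length L; the
-- 3-cycle through X0 pads the closed walks of lengths 3, 4 and 5 to any L ≥ 3.
infix 4 _⟶_
data _⟶_ : State → State → Set where
  X0⟶X1 : X0 ⟶ X1
  X1⟶X2 : X1 ⟶ X2
  X2⟶X0 : X2 ⟶ X0
  X2⟶F0 : X2 ⟶ F0
  X2⟶G0 : X2 ⟶ G0
  F0⟶F1 : F0 ⟶ F1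
  F1⟶F2 : F1 ⟶ F2
  F2⟶F3 : F2 ⟶ F3
  F3⟶X0 : F3 ⟶ X0
  F3⟶F0 : F3 ⟶ F0
  G0⟶G1 : G0 ⟶ G1
  G1⟶G2 : G1 ⟶ G2
  G2⟶G3 : G2 ⟶ G3
  G3⟶G4 : G3 ⟶ G4
  G4⟶X0 : G4 ⟶ X0
  G4⟶G0 : G4 ⟶ G0

unique? : ∀ {m n} (xs : Vec (Fin m) n) → Dec (Unique xs)
unique? = allPairs? (λ x y → ¬? (x ≟ᶠ y))

by-decision : ∀ {m n} {xs : Vec (Fin m) n} → {True (unique? xs)} → Unique xs
by-decision {xs = xs} {p} = toWitness {a? = unique? xs} p

palette-unique : ∀ s → Unique (palette s)
palette-unique X0 = by-decision
palette-unique X1 = by-decision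
palette-unique X2 = by-decision
palette-unique F0 = by-decision
palette-unique F1 = by-decision
palette-unique F2 = by-decision
palette-unique F3 = by-decision
palette-unique G0 = by-decision
palette-unique G1 = by-decision
palette-unique G2 = by-decision
palette-unique G3 = by-decision
palette-unique G4 = by-decision

-- The colours at z when the suns at z − d, z and z + d are coloured by s₀, s₁ and s₂.
pathColours : State → State → State → Vec (Fin 5) 5
pathColours s₀ s₁ s₂ = α s₀ ∷ α s₁ ∷ α s₂ ∷ β s₁ ∷ γ s₀ ∷ []

pathColours-unique : ∀ {s₀ s₁ s₂} → s₀ ⟶ s₁ → s₁ ⟶ s₂ → Unique (pathColours s₀ s₁ s₂)
pathColours-unique X0⟶X1 X1⟶X2 = by-decision
pathColours-unique X1⟶X2 X2⟶X0 = by-decision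
pathColours-unique X1⟶X2 X2⟶F0 = by-decision
pathColours-unique X1⟶X2 X2⟶G0 = by-decision
pathColours-unique X2⟶X0 X0⟶X1 = by-decision
pathColours-unique X2⟶F0 F0⟶F1 = by-decision
pathColours-unique X2⟶G0 G0⟶G1 = by-decision
pathColours-unique F0⟶F1 F1⟶F2 = by-decision
pathColours-unique F1⟶F2 F2⟶F3 = by-decision
pathColours-unique F2⟶F3 F3⟶X0 = by-decision
pathColours-unique F2⟶F3 F3⟶F0 = by-decision
pathColours-unique F3⟶X0 X0⟶X1 = by-decision
pathColours-unique F3⟶F0 F0⟶F1 = by-decision
pathColours-unique G0⟶G1 G1⟶G2 = by-decision
pathColours-unique G1⟶G2 G2⟶G3 = by-decision
pathColours-unique G2⟶G3 G3⟶G4 = by-decision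
pathColours-unique G3⟶G4 G4⟶X0 = by-decision
pathColours-unique G3⟶G4 G4⟶G0 = by-decision
pathColours-unique G4⟶X0 X0⟶X1 = by-decision
pathColours-unique G4⟶G0 G0⟶G1 = by-decision

xWalk fWalk gWalk : ℕ → State
xWalk 0 = X0
xWalk 1 = X1
xWalk 2 = X2
xWalk (suc (suc (suc q))) = xWalk q

fWalk 0 = F0
fWalk 1 = F1
fWalk 2 = F2
fWalk 3 = F3
fWalk (suc (suc (suc (suc q)))) = xWalk q

gWalk 0 = G0
gWalk 1 = G1
gWalk 2 = G2
gWalk 3 = G3
gWalk 4 = G4
gWalk (suc (suc (suc (suc (suc q))))) = xWalk q

xWalk-step : ∀ q → xWalk q ⟶ xWalk (suc q)
xWalk-step 0 = X0⟶X1
xWalk-step 1 = X1⟶X2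
xWalk-step 2 = X2⟶X0
xWalk-step (suc (suc (suc q))) = xWalk-step q

fWalk-step : ∀ q → fWalk q ⟶ fWalk (suc q)
fWalk-step 0 = F0⟶F1
fWalk-step 1 = F1⟶F2
fWalk-step 2 = F2⟶F3
fWalk-step 3 = F3⟶X0
fWalk-step (suc (suc (suc (suc q)))) = xWalk-step q

gWalk-step : ∀ q → gWalk q ⟶ gWalk (suc q)
gWalk-step 0 = G0⟶G1
gWalk-step 1 = G1⟶G2
gWalk-step 2 = G2⟶G3
gWalk-step 3 = G3⟶G4
gWalk-step 4 = G4⟶X0
gWalk-step (suc (suc (suc (suc (suc q))))) = xWalk-step q

triple : ℕ → ℕ
triple zero = zero
triple (suc m) = 3 + triple m

xWalk-2+triple : ∀ m → xWalk (2 + triple m) ≡ X2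
xWalk-2+triple zero = refl
xWalk-2+triple (suc m) = xWalk-2+triple m

xWalk-close : ∀ m → xWalk (2 + triple m) ⟶ xWalk 0
xWalk-close m rewrite xWalk-2+triple m = X2⟶X0

fWalk-close : ∀ m → fWalk (3 + triple m) ⟶ fWalk 0
fWalk-close zero = F3⟶F0
fWalk-close (suc m) rewrite xWalk-2+triple m = X2⟶F0

gWalk-close : ∀ m → gWalk (4 + triple m) ⟶ gWalk 0
gWalk-close zero = G4⟶G0
gWalk-close (suc m) rewrite xWalk-2+triple m = X2⟶G0

record ClosedWalk (L : ℕ) : Set where
  field
    walk  : ℕ → State
    step  : ∀ q → walk q ⟶ walk (suc q)
    close : walk (pred L) ⟶ walk 0

  cyclic-step : .{{_ : NonZero L}} → ∀ q → q < L → walk q ⟶ walk (suc q % L)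
  cyclic-step q q<L with suc q <? L
  ... | yes q+1<L = subst (λ r → walk q ⟶ walk r) (sym (m<n⇒m%n≡m q+1<L)) (step q)
  ... | no q+1≮L with ≤-antisym q<L (≮⇒≥ q+1≮L)
  ...   | refl = subst (λ r → walk q ⟶ walk r) (sym (n%n≡0 (suc q))) close

data Mod3 : ℕ → Set where
  3[m+1]   : ∀ m → Mod3 (triple (suc m))
  3[m+1]+1 : ∀ m → Mod3 (1 + triple (suc m))
  3[m+1]+2 : ∀ m → Mod3 (2 + triple (suc m))

mod3 : ∀ n → Mod3 (3 + n)
mod3 0 = 3[m+1] 0
mod3 1 = 3[m+1]+1 0
mod3 2 = 3[m+1]+2 0
mod3 (suc (suc (suc n))) with mod3 n
... | 3[m+1] m   = 3[m+1] (suc m)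
... | 3[m+1]+1 m = 3[m+1]+1 (suc m)
... | 3[m+1]+2 m = 3[m+1]+2 (suc m)

closedWalk : ∀ L → 3 ≤ L → ClosedWalk L
closedWalk (suc (suc (suc n))) (s≤s (s≤s (s≤s _))) with mod3 n
... | 3[m+1] m   = record { walk = xWalk ; step = xWalk-step ; close = xWalk-close m }
... | 3[m+1]+1 m = record { walk = fWalk ; step = fWalk-step ; close = fWalk-close m }
... | 3[m+1]+2 m = record { walk = gWalk ; step = gWalk-step ; close = gWalk-close m }

d≤u/2∧2d≢u⇒d+d<u : ∀ {u d} → d ≤ u / 2 → 2 * d ≢ u → d + d < u
d≤u/2∧2d≢u⇒d+d<u {u} {d} d≤u/2 2d≢u = subst (_< u) (cong (d +_) (+-identityʳ d)) (≤∧≢⇒< 2d≤u 2d≢u)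
  where
  2d≤u : 2 * d ≤ u
  2d≤u = begin
    2 * d        ≤⟨ *-monoʳ-≤ 2 d≤u/2 ⟩
    2 * (u / 2)  ≡⟨ *-comm 2 (u / 2) ⟩
    u / 2 * 2    ≤⟨ m/n*n≤m u 2 ⟩
    u            ∎

lemma2p14 : (u d : ℕ) → 3 ≤ u → 1 ≤ d → d ≤ u / 2 → ¬ (2 * d ≡ u) →
            SunDecomposition (CirculantPlusInf u 5 d)
lemma2p14 u d 3≤u 1≤d d≤u/2 2d≢u =
  sunDecomposition colour (λ x → palette-unique (walk (pos x))) vertexColours-unique
  where
  instance
    u≢0 : NonZero u
    u≢0 = >-nonZero (≤-trans (s≤s z≤n) 3≤u)

  d+d<u : d + d < u
  d+d<u = d≤u/2∧2d≢u⇒d+d<u d≤u/2 2d≢u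

  open CyclePosition u d 1≤d d+d<u
  open CirculantSuns u d (<⇒≤ d+d<u)
  open ClosedWalk (closedWalk L 3≤L)

  pos : Fin u → ℕ
  pos x = position (toℕ x)

  colour : Fin u → Vec (Fin 5) 3
  colour x = palette (walk (pos x))

  walk-along-P : ∀ x → walk (pos x) ⟶ walk (pos (P x))
  walk-along-P x = subst (λ q → walk (pos x) ⟶ walk q) (sym (position-shift x))
                         (cyclic-step (pos x) (m%n<n _ L))

  vertexColours-unique : ∀ z → Unique (vertexColours colour z)
  vertexColours-unique z = pathColours-unique
    (subst (λ y → walk (pos (M z)) ⟶ walk (pos y)) (P∘M z) (walk-along-P (M z)))
    (walk-along-P z)
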